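{- In Ruleset C, for a superposition $\langle \mathrm{Nim}(i_1),\dots,\mathrm{Nim}(i_\ell)\rangle_C$ of pairwise distinct single Nim heaps with $k=\max_{1\le j\le\ell} i_j$: its value is $*k$ if $\ell=1$, and $*(k-1)$ otherwise.
   Context: $\mathrm{Nim}(x)$ is a single Nim heap of $x$ tokens; a classical move $(1,-j)$, $j\ge1$, removes $j$ tokens and is legal iff $x\ge j$. Quantum variation: a quantum position is a finite nonempty set $\langle G_1,\dots,G_n\rangle$ of classical positions (so its elements are distinct). A classical move is legal in it if legal in at least one $G_i$. A Q-move is a finite nonempty set of classical moves, each legal in the current quantum position; it leads to the set of all positions obtained by applying one of its moves to one of the $G_i$ where that move is legal. A Q-move with a single classical move is unsuperposed. Ruleset C (subscript $C$): Q-moves with at least two distinct classical moves are allowed; an unsuperposed move $m$ is allowed iff $m$ is legal in every $G_i$ of the superposition. Normal convention: a player with no allowed Q-move loses. $*n$ denotes the value (equivalence class under $G\equiv H$ iff $G+X$, $H+X$ have the same outcome for all games $X$) of a classical Nim heap of $n$ tokens, with $*0=0$. -}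

module Defs where

open import Data.Nat using (ℕ; zero; suc; _∸_; _⊔_; _≤ᵇ_; _≡ᵇ_)
open import Data.Bool using (Bool; true; false; _∧_; _∨_; not)
open import Data.Fin using (Fin; toℕ; splitAt)
open import Data.Vec using (Vec; []; _∷_; lookup)
open import Data.List using (List; []; _∷_; map; _++_; upTo; allFin; filterᵇ; length; foldr)
import Data.List as L
open import Data.Bool.ListAction using (any; all)
open import Data.Sum using (inj₁; inj₂; [_,_])
open import Data.Product using (Σ; _×_)
open import Relation.Nullary using (¬_)
open import Function.Bundles using (_⇔_)

data Game : Set where
  game : (nL nR : ℕ) → (Fin nL → Game) → (Fin nR → Game) → Game

infixl 6 _⊕_
_⊕_ : Game → Game → Game
game a b GL GR ⊕ game c d HL HR =
  game (a Data.Nat.+ c) (b Data.Nat.+ d)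
    (λ i → [ (λ i → GL i ⊕ game c d HL HR) , (λ j → game a b GL GR ⊕ HL j) ] (splitAt a i))
    (λ i → [ (λ i → GR i ⊕ game c d HL HR) , (λ j → game a b GL GR ⊕ HR j) ] (splitAt b i))

mutual
  LeftFirstWins : Game → Set
  LeftFirstWins (game _ _ GL _) = Σ _ λ i → ¬ RightFirstWins (GL i)

  RightFirstWins : Game → Set
  RightFirstWins (game _ _ _ GR) = Σ _ λ j → ¬ LeftFirstWins (GR j)

SameOutcome : Game → Game → Set
SameOutcome G H = (LeftFirstWins G ⇔ LeftFirstWins H) × (RightFirstWins G ⇔ RightFirstWins H)

_≈G_ : Game → Game → Set
G ≈G H = ∀ (X : Game) → SameOutcome (G ⊕ X) (H ⊕ X)

imp : (n : ℕ) → (Fin n → Game) → Game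
imp n f = game n n f f

-- Classical Nim heap: option i of nim k is nim (k - 1 - i)
nimOpts : (k : ℕ) → Fin k → Game
nimOpts (suc k) Fin.zero = imp k (nimOpts k)
nimOpts (suc k) (Fin.suc i) = nimOpts k i

nim : ℕ → Game
nim k = imp k (nimOpts k)

-- Quantum Nim on single heaps, ruleset C.
-- A quantum position is a set of heap sizes, given by a Boolean
-- characteristic function S; qgame (suc m) S assumes all elements ≤ m.

allVecs : (m : ℕ) → List (Vec Bool m)
allVecs zero = [] ∷ []
allVecs (suc m) = map (true ∷_) (allVecs m) ++ map (false ∷_) (allVecs m)

-- the classical moves (numbers of removed tokens) selected by M:
-- index i of M stands for removing (suc i) tokens
selected : {m : ℕ} → Vec Bool m → List ℕ
selected {m} M = map (λ i → suc (toℕ i)) (filterᵇ (lookup M) (allFin m))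

module _ (m : ℕ) (S : ℕ → Bool) where
  heaps : List ℕ
  heaps = upTo (suc m)

  legalSome : ℕ → Bool
  legalSome j = any (λ x → S x ∧ (j ≤ᵇ x)) heaps

  legalAll : ℕ → Bool
  legalAll j = all (λ x → not (S x) ∨ (j ≤ᵇ x)) heaps

  allowedC : List ℕ → Bool
  allowedC js = all legalSome js ∧ shape js
    where
    shape : List ℕ → Bool
    shape [] = false
    shape (j ∷ []) = legalAll j
    shape (_ ∷ _ ∷ _) = true

  result : List ℕ → ℕ → Bool
  result js y = any (λ x → S x ∧ any (λ j → (j ≤ᵇ x) ∧ ((x ∸ j) ≡ᵇ y)) js) heaps

  allowedQMoves : List (List ℕ)
  allowedQMoves = filterᵇ allowedC (map selected (allVecs m))

qgame : ℕ → (ℕ → Bool) → Game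
qgame zero S = imp 0 (λ ())
qgame (suc m) S = imp (length qs) (λ i → qgame m (result m S (L.lookup qs i)))
  where
  qs = allowedQMoves m S

maxList : List ℕ → ℕ
maxList = foldr _⊔_ 0

quantumNim : List ℕ → Game
quantumNim is = qgame (suc (maxList is)) (λ y → any (y ≡ᵇ_) is)

module Submission where

-- The theorem follows by induction on the
-- level bounding the heaps from a mex rule: an impartial game all of whose options
-- are equivalent to heaps smaller than v, and which reaches every heap smaller
-- than v, is equivalent to the heap of size v.
--
-- The core computes the
-- result of a Q-move: after an unsuperposed move the shape (singleton or not) is
-- preserved, after a superposed move the result never is a singleton; in both
-- cases the predicted value strictly drops, and the moves j = k ∸ t (singleton)
-- or {k ∸ (t + 1), k} (otherwise) reach every smaller value t.

open import Defs
open import Data.Bool using (Bool; true; false; T; T?; not; _∨_)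
open import Data.Bool.Properties using (T-∧)
open import Data.Bool.ListAction using (any; all)
open import Data.Empty using (⊥-elim)
open import Data.Fin using (Fin; toℕ; _↑ˡ_; _↑ʳ_; splitAt)
import Data.Fin as Fin
open import Data.Fin.Properties using (splitAt-↑ˡ; splitAt-↑ʳ)
open import Data.List using (List; []; _∷_; length; upTo; map; filterᵇ; tabulate; allFin)
import Data.List as L
open import Data.List.Properties using (map-∘)
open import Data.List.Membership.Propositional using (_∈_; find; lose)
open import Data.List.Membership.Propositional.Properties
  using (∈-upTo⁺; ∈-upTo⁻; ∈-map⁺; ∈-map⁻; ∈-++⁺ˡ; ∈-++⁺ʳ; ∈-filter⁺; ∈-filter⁻; ∈-lookup)
open import Data.List.Relation.Unary.All using (All; []; _∷_)
import Data.List.Relation.Unary.All as All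
open import Data.List.Relation.Unary.All.Properties using (all⁺; all⁻)
import Data.List.Relation.Unary.All.Properties as Allₚ
open import Data.List.Relation.Unary.AllPairs using (AllPairs; _∷_)
import Data.List.Relation.Unary.AllPairs.Properties as AllPairsₚ
open import Data.List.Relation.Unary.Any using (here; there)
import Data.List.Relation.Unary.Any as Any
open import Data.List.Relation.Unary.Any.Properties using (any⁺; any⁻; lookup-index)
open import Data.List.Relation.Unary.Unique.Propositional using (Unique)
open import Data.Nat using (ℕ; zero; suc; _+_; _<_; _≤_; _∸_; _≡ᵇ_; z≤n; s≤s)
open import Data.Nat.Properties
  using (_≟_; ≤-refl; ≤-trans; ≤-pred; <⇒≤; ≤-<-trans; <-≤-trans; ≤∧≢⇒<; n≮0; m≤n⇒m<n∨m≡n; m<n⇒m<1+n;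
         +-comm; ∸-+-assoc; ∸-mono; ∸-monoˡ-<; ∸-monoʳ-<; m∸n≤m; m<n⇒0<n∸m; m∸[m∸n]≡n;
         m≤m⊔n; m≤n⊔m; ⊔-identityʳ; ⊔-sel; ≤ᵇ⇒≤; ≤⇒≤ᵇ; ≡ᵇ⇒≡; ≡⇒≡ᵇ; module ≤-Reasoning)
open import Data.Product using (Σ; _×_; _,_; proj₁; proj₂)
open import Data.Sum using (_⊎_; inj₁; inj₂; [_,_])
open import Data.Unit using (tt)
open import Data.Vec using (Vec; []; _∷_)
import Data.Vec as V
open import Function using (_∘_; id)
open import Function.Bundles using (_⇔_; mk⇔; Equivalence)
import Function.Properties.Equivalence as ⇔
open import Relation.Nullary using (¬_; yes; no)
open import Relation.Binary.PropositionalEquality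
  using (_≡_; _≢_; refl; sym; trans; cong; subst; module ≡-Reasoning)

open Equivalence using (to; from)

≈G-sym : ∀ {G H} → G ≈G H → H ≈G G
≈G-sym G≈H X = ⇔.sym (proj₁ (G≈H X)) , ⇔.sym (proj₂ (G≈H X))

module _ (P : Game → Set) {a c : ℕ} {F : Fin a → Game} {K : Fin c → Game} where

  OptionOfSum : Set
  OptionOfSum = Σ (Fin (a + c)) λ s → P ([ F , K ] (splitAt a s))

  inFirst : (i : Fin a) → P (F i) → OptionOfSum
  inFirst i p = i ↑ˡ c , subst (P ∘ [ F , K ]) (sym (splitAt-↑ˡ a i c)) p

  inSecond : (j : Fin c) → P (K j) → OptionOfSum
  inSecond j p = a ↑ʳ j , subst (P ∘ [ F , K ]) (sym (splitAt-↑ʳ a c j)) p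

  optionCases : OptionOfSum → (Σ (Fin a) (P ∘ F)) ⊎ (Σ (Fin c) (P ∘ K))
  optionCases (s , p) = byComponent (splitAt a s) p
    where
    byComponent : (s : Fin a ⊎ Fin c) → P ([ F , K ] s) → (Σ (Fin a) (P ∘ F)) ⊎ (Σ (Fin c) (P ∘ K))
    byComponent (inj₁ i) p = inj₁ (i , p)
    byComponent (inj₂ j) p = inj₂ (j , p)

Covers : ∀ {n m} → (Fin n → Game) → (Fin m → Game) → Set
Covers {n} {m} f g = (i : Fin n) → Σ (Fin m) λ j → f i ≈G g j

-- A winning first move in imp n f ⊕ X is answered in imp m g ⊕ X: a move in
-- imp n f by an equivalent move of imp m g, a move in X by the hypothesis
-- about the smaller sums (which coveringEquiv supplies by induction on X).
module _ {n m : ℕ} {f : Fin n → Game} {g : Fin m → Game} (cover : Covers f g)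
         {c d : ℕ} {XL : Fin c → Game} {XR : Fin d → Game} where
  private
    X : Game
    X = game c d XL XR

  leftTransfer : (∀ j → RightFirstWins (imp m g ⊕ XL j) → RightFirstWins (imp n f ⊕ XL j)) →
                 LeftFirstWins (imp n f ⊕ X) → LeftFirstWins (imp m g ⊕ X)
  leftTransfer ih w with optionCases (¬_ ∘ RightFirstWins) w
  ... | inj₁ (i , h) = let (j , fi≈gj) = cover i in
                       inFirst (¬_ ∘ RightFirstWins) j (h ∘ from (proj₂ (fi≈gj X)))
  ... | inj₂ (j , h) = inSecond (¬_ ∘ RightFirstWins) j (h ∘ ih j)

  rightTransfer : (∀ j → LeftFirstWins (imp m g ⊕ XR j) → LeftFirstWins (imp n f ⊕ XR j)) →
                  RightFirstWins (imp n f ⊕ X) → RightFirstWins (imp m g ⊕ X)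
  rightTransfer ih w with optionCases (¬_ ∘ LeftFirstWins) w
  ... | inj₁ (i , h) = let (j , fi≈gj) = cover i in
                       inFirst (¬_ ∘ LeftFirstWins) j (h ∘ from (proj₁ (fi≈gj X)))
  ... | inj₂ (j , h) = inSecond (¬_ ∘ LeftFirstWins) j (h ∘ ih j)

coveringEquiv : ∀ {n m} {f : Fin n → Game} {g : Fin m → Game} →
                Covers f g → Covers g f → imp n f ≈G imp m g
coveringEquiv f⊑g g⊑f (game c d XL XR) =
  mk⇔ (leftTransfer f⊑g (λ j → from (proj₂ (coveringEquiv f⊑g g⊑f (XL j)))))
      (leftTransfer g⊑f (λ j → to (proj₂ (coveringEquiv f⊑g g⊑f (XL j))))) ,
  mk⇔ (rightTransfer f⊑g (λ j → from (proj₁ (coveringEquiv f⊑g g⊑f (XR j)))))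
      (rightTransfer g⊑f (λ j → to (proj₁ (coveringEquiv f⊑g g⊑f (XR j)))))

nimOption : ∀ {a v} → a < v → Σ (Fin v) λ i → nimOpts v i ≡ nim a
nimOption {v = suc v} (s≤s a≤v) with m≤n⇒m<n∨m≡n a≤v
... | inj₁ a<v = let (i , eq) = nimOption a<v in Fin.suc i , eq
... | inj₂ refl = Fin.zero , refl

nimOptionBelow : ∀ {v} (i : Fin v) → Σ ℕ λ t → t < v × nimOpts v i ≡ nim t
nimOptionBelow {suc v} Fin.zero = v , ≤-refl , refl
nimOptionBelow {suc v} (Fin.suc i) = let (t , t<v , eq) = nimOptionBelow i in t , m<n⇒m<1+n t<v , eq

mexRule : ∀ {n v} (f : Fin n → Game) →
          (∀ i → Σ ℕ λ t → t < v × f i ≈G nim t) →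
          (∀ t → t < v → Σ (Fin n) λ i → f i ≈G nim t) →
          imp n f ≈G nim v
mexRule f below reaches = coveringEquiv optionsCovered nimCovered
  where
  optionsCovered : Covers f (nimOpts _)
  optionsCovered i = let (t , t<v , fi≈t) = below i ; (j , eq) = nimOption t<v in
                     j , subst (f i ≈G_) (sym eq) fi≈t
  nimCovered : Covers (nimOpts _) f
  nimCovered j = let (t , t<v , eq) = nimOptionBelow j ; (i , fi≈t) = reaches t t<v in
                 i , subst (_≈G f i) (sym eq) (≈G-sym fi≈t)

T-implication : ∀ b c → T (not b ∨ c) ⇔ (T b → T c)
T-implication true c = mk⇔ (λ tc _ → tc) (λ f → f tt)
T-implication false c = mk⇔ (λ _ ()) (λ _ → tt)

module _ (m : ℕ) (p : ℕ → Bool) where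

  someHeap⇒ : T (any p (upTo (suc m))) → Σ ℕ λ x → x ≤ m × T (p x)
  someHeap⇒ t = let (x , x∈ , px) = find (any⁻ p _ t) in x , ≤-pred (∈-upTo⁻ x∈) , px

  someHeap⇐ : ∀ {x} → x ≤ m → T (p x) → T (any p (upTo (suc m)))
  someHeap⇐ x≤m px = any⁺ p (lose (∈-upTo⁺ (s≤s x≤m)) px)

  everyHeap⇒ : T (all p (upTo (suc m))) → ∀ {x} → x ≤ m → T (p x)
  everyHeap⇒ t x≤m = All.lookup (all⁺ p _ t) (∈-upTo⁺ (s≤s x≤m))

  everyHeap⇐ : (∀ {x} → x ≤ m → T (p x)) → T (all p (upTo (suc m)))
  everyHeap⇐ h = all⁻ p (All.tabulate (h ∘ ≤-pred ∘ ∈-upTo⁻))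

module _ (m : ℕ) (S : ℕ → Bool) where

  legalSome⇒ : ∀ {j} → T (legalSome m S j) → Σ ℕ λ x → x ≤ m × T (S x) × j ≤ x
  legalSome⇒ {j} t = let (x , x≤m , px) = someHeap⇒ m _ t ; (sx , j≤ᵇx) = to T-∧ px in
                     x , x≤m , sx , ≤ᵇ⇒≤ j x j≤ᵇx

  legalSome⇐ : ∀ {j x} → x ≤ m → T (S x) → j ≤ x → T (legalSome m S j)
  legalSome⇐ x≤m sx j≤x = someHeap⇐ m _ x≤m (from T-∧ (sx , ≤⇒≤ᵇ j≤x))

  legalAll⇒ : ∀ {j} → T (legalAll m S j) → ∀ {x} → x ≤ m → T (S x) → j ≤ x
  legalAll⇒ {j} t {x} x≤m sx = ≤ᵇ⇒≤ j x (to (T-implication (S x) _) (everyHeap⇒ m _ t x≤m) sx)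

  legalAll⇐ : ∀ {j} → (∀ {x} → x ≤ m → T (S x) → j ≤ x) → T (legalAll m S j)
  legalAll⇐ h = everyHeap⇐ m _ λ {x} x≤m → from (T-implication (S x) _) (≤⇒≤ᵇ ∘ h x≤m)

  result⇒ : ∀ {js y} → T (result m S js y) →
            Σ ℕ λ x → x ≤ m × T (S x) × Σ ℕ λ j → j ∈ js × j ≤ x × x ∸ j ≡ y
  result⇒ {js} {y} t =
    let (x , x≤m , px) = someHeap⇒ m _ t
        (sx , moves) = to T-∧ px
        (j , j∈js , q) = find (any⁻ _ js moves)
        (j≤ᵇx , eq) = to T-∧ q
    in x , x≤m , sx , j , j∈js , ≤ᵇ⇒≤ j x j≤ᵇx , ≡ᵇ⇒≡ (x ∸ j) y eq

  result⇐ : ∀ {js x j} → x ≤ m → T (S x) → j ∈ js → j ≤ x → T (result m S js (x ∸ j))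
  result⇐ {x = x} {j} x≤m sx j∈js j≤x =
    someHeap⇐ m _ x≤m (from T-∧ (sx , any⁺ _ (lose j∈js (from T-∧ (≤⇒≤ᵇ j≤x , ≡⇒≡ᵇ (x ∸ j) (x ∸ j) refl)))))

  allowedC⇒legalSome : ∀ {js} → T (allowedC m S js) → All (T ∘ legalSome m S) js
  allowedC⇒legalSome {js} allowed = all⁺ (legalSome m S) js (proj₁ (to (T-∧ {all (legalSome m S) js}) allowed))

  allowedSingle⇒ : ∀ {j} → T (allowedC m S (j ∷ [])) → T (legalAll m S j)
  allowedSingle⇒ {j} allowed = proj₂ (to (T-∧ {all (legalSome m S) (j ∷ [])}) allowed)

  allowedSingle⇐ : ∀ {j} → T (legalSome m S j) → T (legalAll m S j) → T (allowedC m S (j ∷ []))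
  allowedSingle⇐ some every = from T-∧ (from T-∧ (some , tt) , every)

  allowedPair⇐ : ∀ {j₁ j₂} → T (legalSome m S j₁) → T (legalSome m S j₂) → T (allowedC m S (j₁ ∷ j₂ ∷ []))
  allowedPair⇐ some₁ some₂ = from T-∧ (from T-∧ (some₁ , from T-∧ (some₂ , tt)) , tt)

filter-shift : ∀ {n m} (b : Bool) (M : Vec Bool m) (h : Fin n → Fin m) →
               filterᵇ (V.lookup (b ∷ M)) (tabulate (Fin.suc ∘ h)) ≡ map Fin.suc (filterᵇ (V.lookup M) (tabulate h))
filter-shift {zero} b M h = refl
filter-shift {suc n} b M h with V.lookup M (h Fin.zero)
... | true = cong (Fin.suc (h Fin.zero) ∷_) (filter-shift b M (h ∘ Fin.suc))
... | false = filter-shift b M (h ∘ Fin.suc)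

selected-shift : ∀ {m} (b : Bool) (M : Vec Bool m) →
                 map (suc ∘ toℕ) (filterᵇ (V.lookup (b ∷ M)) (tabulate Fin.suc)) ≡ map suc (selected M)
selected-shift {m} b M = begin
  map (suc ∘ toℕ) (filterᵇ (V.lookup (b ∷ M)) (tabulate Fin.suc))   ≡⟨ cong (map (suc ∘ toℕ)) (filter-shift b M id) ⟩
  map (suc ∘ toℕ) (map Fin.suc chosen)                              ≡⟨ sym (map-∘ chosen) ⟩
  map (suc ∘ suc ∘ toℕ) chosen                                      ≡⟨ map-∘ chosen ⟩
  map suc (selected M)                                              ∎
  where
  open ≡-Reasoning
  chosen : List (Fin m)
  chosen = filterᵇ (V.lookup M) (allFin _)

selected-true : ∀ {m} (M : Vec Bool m) → selected (true ∷ M) ≡ 1 ∷ map suc (selected M)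
selected-true M = cong (1 ∷_) (selected-shift true M)

selected-false : ∀ {m} (M : Vec Bool m) → selected (false ∷ M) ≡ map suc (selected M)
selected-false M = selected-shift false M

selected-increasing : ∀ {m} (M : Vec Bool m) → AllPairs _<_ (selected M)
selected-increasing M = AllPairsₚ.map⁺ (AllPairsₚ.filter⁺ _ (AllPairsₚ.tabulate⁺-< s≤s))

selected-positive : ∀ {m} (M : Vec Bool m) → All (0 <_) (selected M)
selected-positive M = Allₚ.map⁺ (All.universal (λ _ → s≤s z≤n) _)

selected-none : ∀ m → selected (V.replicate m false) ≡ []
selected-none zero = refl
selected-none (suc m) = trans (selected-false _) (cong (map suc) (selected-none m))

singleMoveVec : (m j : ℕ) → Vec Bool m
singleMoveVec (suc m) (suc zero) = true ∷ V.replicate m false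
singleMoveVec (suc m) (suc (suc j)) = false ∷ singleMoveVec m (suc j)
singleMoveVec m _ = V.replicate m false

selected-singleMoveVec : ∀ {m j} → 0 < j → j ≤ m → selected (singleMoveVec m j) ≡ j ∷ []
selected-singleMoveVec {suc m} {suc zero} _ _ =
  trans (selected-true _) (cong (λ js → 1 ∷ map suc js) (selected-none m))
selected-singleMoveVec {suc m} {suc (suc j)} _ (s≤s j<m) =
  trans (selected-false _) (cong (map suc) (selected-singleMoveVec (s≤s z≤n) j<m))

pairMoveVec : (m j₁ j₂ : ℕ) → Vec Bool m
pairMoveVec (suc m) (suc zero) (suc j₂) = true ∷ singleMoveVec m j₂
pairMoveVec (suc m) (suc (suc j₁)) (suc j₂) = false ∷ pairMoveVec m (suc j₁) j₂
pairMoveVec m _ _ = V.replicate m false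

selected-pairMoveVec : ∀ {m j₁ j₂} → 0 < j₁ → j₁ < j₂ → j₂ ≤ m → selected (pairMoveVec m j₁ j₂) ≡ j₁ ∷ j₂ ∷ []
selected-pairMoveVec {suc m} {suc zero} {suc j₂} _ (s≤s 0<j₂) (s≤s j₂≤m) =
  trans (selected-true _) (cong (λ js → 1 ∷ map suc js) (selected-singleMoveVec 0<j₂ j₂≤m))
selected-pairMoveVec {suc m} {suc (suc j₁)} {suc j₂} _ (s≤s j₁<j₂) (s≤s j₂≤m) =
  trans (selected-false _) (cong (map suc) (selected-pairMoveVec (s≤s z≤n) j₁<j₂ j₂≤m))

allVecs-complete : ∀ {m} (M : Vec Bool m) → M ∈ allVecs m
allVecs-complete [] = here refl
allVecs-complete (true ∷ M) = ∈-++⁺ˡ (∈-map⁺ (true ∷_) (allVecs-complete M))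
allVecs-complete {suc m} (false ∷ M) = ∈-++⁺ʳ (map (true ∷_) (allVecs m)) (∈-map⁺ (false ∷_) (allVecs-complete M))

module _ (m : ℕ) (S : ℕ → Bool) where

  Offered : List ℕ → Set
  Offered js = Σ (Fin (length (allowedQMoves m S))) λ i → L.lookup (allowedQMoves m S) i ≡ js

  offered : ∀ {js} (M : Vec Bool m) → selected M ≡ js → T (allowedC m S js) → Offered js
  offered M refl allowed = Any.index js∈ , sym (lookup-index js∈)
    where
    js∈ : selected M ∈ allowedQMoves m S
    js∈ = ∈-filter⁺ (T? ∘ allowedC m S) (∈-map⁺ selected (allVecs-complete M)) allowed

  offeredShape : (i : Fin (length (allowedQMoves m S))) → let js = L.lookup (allowedQMoves m S) i in
                 AllPairs _<_ js × All (0 <_) js × T (allowedC m S js)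
  offeredShape i with ∈-filter⁻ (T? ∘ allowedC m S) {xs = map selected (allVecs m)} (∈-lookup i)
  ... | js∈ , allowed with ∈-map⁻ selected js∈
  ...   | M , _ , eq = subst (AllPairs _<_) (sym eq) (selected-increasing M) ,
                       subst (All (0 <_)) (sym eq) (selected-positive M) , allowed

IsMax : ℕ → (ℕ → Bool) → ℕ → Set
IsMax m S k = T (S k) × k ≤ m × (∀ {x} → x ≤ m → T (S x) → x ≤ k)

IsOnly : ℕ → (ℕ → Bool) → ℕ → Set
IsOnly m S k = ∀ {x} → x ≤ m → T (S x) → x ≡ k

HasBelow : (ℕ → Bool) → ℕ → Set
HasBelow S k = Σ ℕ λ x → x < k × T (S x)

data Value (m : ℕ) (S : ℕ → Bool) (k : ℕ) : ℕ → Set where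
  single : IsOnly m S k → Value m S k k
  multi  : HasBelow S k → Value m S k (k ∸ 1)

HasValue : ℕ → (ℕ → Bool) → ℕ → Set
HasValue m S a = Σ ℕ λ k → IsMax m S k × Value m S k a

value≤max : ∀ {m S k a} → Value m S k a → a ≤ k
value≤max (single _) = ≤-refl
value≤max {k = k} (multi _) = m∸n≤m k 1

max∸1≤value : ∀ {m S k a} → Value m S k a → k ∸ 1 ≤ a
max∸1≤value {k = k} (single _) = m∸n≤m k 1
max∸1≤value (multi _) = ≤-refl

∸-shrinks : ∀ {k j} → 0 < j → j < k → k ∸ j ∸ 1 < k ∸ 1
∸-shrinks {k} {j} 0<j j<k = begin-strict
  k ∸ j ∸ 1    ≡⟨ ∸-+-assoc k j 1 ⟩
  k ∸ (j + 1)  ≡⟨ cong (k ∸_) (+-comm j 1) ⟩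
  k ∸ suc j    <⟨ ∸-monoʳ-< (s≤s 0<j) j<k ⟩
  k ∸ 1        ∎
  where open ≤-Reasoning

module _ {m : ℕ} {S : ℕ → Bool} where

  resultMax : ∀ {k} j js → IsMax (suc m) S k → j ∈ js → All (j ≤_) js → 0 < j → j ≤ k →
              IsMax m (result (suc m) S js) (k ∸ j)
  resultMax {k} j js (sk , k≤ , maximal) j∈js j≤js 0<j j≤k =
    result⇐ (suc m) S {js} k≤ sk j∈js j≤k , ∸-mono k≤ 0<j , bounded
    where
    bounded : ∀ {y} → y ≤ m → T (result (suc m) S js y) → y ≤ k ∸ j
    bounded {y} _ ry with result⇒ (suc m) S {js} {y} ry
    ... | x , x≤ , sx , j′ , j′∈js , _ , refl = ∸-mono (maximal x≤ sx) (All.lookup j≤js j′∈js)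

  resultOnly : ∀ {k} j → IsOnly (suc m) S k → IsOnly m (result (suc m) S (j ∷ [])) (k ∸ j)
  resultOnly j only {y} _ ry with result⇒ (suc m) S {j ∷ []} {y} ry
  ... | x , x≤ , sx , _ , here refl , _ , refl = cong (_∸ j) (only x≤ sx)

  -- An unsuperposed move j
  -- keeps a singleton a singleton (value k ∸ j < k) and, being legal in the smaller
  -- heap x, keeps a non-singleton one (value k ∸ j ∸ 1 < k ∸ 1).  A superposed move
  -- j₁ < j₂ leaves the heaps k ∸ j₁ > k ∸ j₂, hence has value k ∸ j₁ ∸ 1 < k ∸ 1.
  optionValue : ∀ {k a js} → IsMax (suc m) S k → Value (suc m) S k a →
                AllPairs _<_ js → All (0 <_) js → T (allowedC (suc m) S js) →
                Σ ℕ λ b → b < a × HasValue m (result (suc m) S js) b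
  optionValue {k} {js = j ∷ []} isMax@(sk , k≤ , _) (single only) _ (0<j ∷ []) allowed =
    k ∸ j , ∸-monoʳ-< 0<j j≤k , k ∸ j , resultMax j (j ∷ []) isMax (here refl) (≤-refl ∷ []) 0<j j≤k , single (resultOnly j only)
    where
    j≤k : j ≤ k
    j≤k = legalAll⇒ (suc m) S (allowedSingle⇒ (suc m) S {j} allowed) k≤ sk
  optionValue {k} {js = j ∷ []} isMax@(_ , k≤ , _) (multi (x , x<k , sx)) _ (0<j ∷ []) allowed =
    k ∸ j ∸ 1 , ∸-shrinks 0<j j<k ,
    k ∸ j , resultMax j (j ∷ []) isMax (here refl) (≤-refl ∷ []) 0<j (<⇒≤ j<k) ,
    multi (x ∸ j , ∸-monoˡ-< x<k j≤x , result⇐ (suc m) S {j ∷ []} x≤ sx (here refl) j≤x)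
    where
    x≤ : x ≤ suc m
    x≤ = ≤-trans (<⇒≤ x<k) k≤
    j≤x : j ≤ x
    j≤x = legalAll⇒ (suc m) S (allowedSingle⇒ (suc m) S {j} allowed) x≤ sx
    j<k : j < k
    j<k = ≤-<-trans j≤x x<k
  optionValue {k} {js = j₁ ∷ j₂ ∷ js} isMax@(sk , k≤ , maximal) v (j₁<rest ∷ _) (0<j₁ ∷ _) allowed =
    k ∸ j₁ ∸ 1 , <-≤-trans (∸-shrinks 0<j₁ j₁<k) (max∸1≤value v) ,
    k ∸ j₁ , resultMax j₁ (j₁ ∷ j₂ ∷ js) isMax (here refl) (≤-refl ∷ All.map <⇒≤ j₁<rest) 0<j₁ (<⇒≤ j₁<k) ,
    multi (k ∸ j₂ , ∸-monoʳ-< j₁<j₂ j₂≤k , result⇐ (suc m) S {j₁ ∷ j₂ ∷ js} k≤ sk (there (here refl)) j₂≤k)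
    where
    j₁<j₂ : j₁ < j₂
    j₁<j₂ = All.head j₁<rest
    j₂≤k : j₂ ≤ k
    j₂≤k with legalSome⇒ (suc m) S {j₂} (All.head (All.tail (allowedC⇒legalSome (suc m) S {j₁ ∷ j₂ ∷ js} allowed)))
    ... | x , x≤ , sx , j₂≤x = ≤-trans j₂≤x (maximal x≤ sx)
    j₁<k : j₁ < k
    j₁<k = <-≤-trans j₁<j₂ j₂≤k

  -- Every smaller value t is the predicted value of some offered option: from the
  -- singleton {k} the move k ∸ t, otherwise the superposed move {k ∸ (t + 1), k},
  -- which leaves the heaps t + 1 and 0.
  reachable : ∀ {k a t} → IsMax (suc m) S k → Value (suc m) S k a → t < a →
              Σ (List ℕ) λ js → Offered (suc m) S js × HasValue m (result (suc m) S js) t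
  reachable {k} {t = t} isMax@(sk , k≤ , _) (single only) t<k =
    j ∷ [] , offered (suc m) S (singleMoveVec (suc m) j) (selected-singleMoveVec 0<j (≤-trans j≤k k≤)) allowed ,
    k ∸ j , resultMax j (j ∷ []) isMax (here refl) (≤-refl ∷ []) 0<j j≤k ,
    subst (Value m (result (suc m) S (j ∷ [])) (k ∸ j)) (m∸[m∸n]≡n (<⇒≤ t<k)) (single (resultOnly j only))
    where
    j : ℕ
    j = k ∸ t
    0<j : 0 < j
    0<j = m<n⇒0<n∸m t<k
    j≤k : j ≤ k
    j≤k = m∸n≤m k t
    allowed : T (allowedC (suc m) S (j ∷ []))
    allowed = allowedSingle⇐ (suc m) S {j} (legalSome⇐ (suc m) S k≤ sk j≤k)
                (legalAll⇐ (suc m) S λ x≤ sx → subst (j ≤_) (sym (only x≤ sx)) j≤k)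
  reachable {k} {t = t} isMax@(sk , k≤ , _) (multi (x , x<k , _)) t<k∸1 =
    j ∷ k ∷ [] , offered (suc m) S (pairMoveVec (suc m) j k) (selected-pairMoveVec 0<j j<k k≤) allowed ,
    k ∸ j , resultMax j (j ∷ k ∷ []) isMax (here refl) (≤-refl ∷ <⇒≤ j<k ∷ []) 0<j (<⇒≤ j<k) ,
    subst (Value m (result (suc m) S (j ∷ k ∷ [])) (k ∸ j)) (cong (_∸ 1) (m∸[m∸n]≡n (<⇒≤ 1+t<k)))
      (multi (k ∸ k , ∸-monoʳ-< j<k ≤-refl , result⇐ (suc m) S {j ∷ k ∷ []} k≤ sk (there (here refl)) ≤-refl))
    where
    1+t<k : suc t < k
    1+t<k = ≤-<-trans t<k∸1 (∸-monoʳ-< (s≤s z≤n) (≤-trans (s≤s z≤n) x<k))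
    j : ℕ
    j = k ∸ suc t
    0<j : 0 < j
    0<j = m<n⇒0<n∸m 1+t<k
    j<k : j < k
    j<k = ∸-monoʳ-< (s≤s z≤n) (<⇒≤ 1+t<k)
    allowed : T (allowedC (suc m) S (j ∷ k ∷ []))
    allowed = allowedPair⇐ (suc m) S {j} {k} (legalSome⇐ (suc m) S k≤ sk (<⇒≤ j<k)) (legalSome⇐ (suc m) S k≤ sk ≤-refl)

qOption : (m : ℕ) (S : ℕ → Bool) → Fin (length (allowedQMoves m S)) → Game
qOption m S i = qgame m (result m S (L.lookup (allowedQMoves m S) i))

quantumValue : ∀ m {S k a} → IsMax m S k → Value m S k a → qgame (suc m) S ≈G nim a
quantumValue zero (_ , k≤0 , _) v =
  mexRule _ (λ ()) (λ t t<a → ⊥-elim (n≮0 (≤-trans t<a (≤-trans (value≤max v) k≤0))))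
quantumValue (suc m) {S} {a = a} isMax v = mexRule (qOption (suc m) S) optionsBelow reachesBelow
  where
  optionsBelow : ∀ i → Σ ℕ λ b → b < a × qOption (suc m) S i ≈G nim b
  optionsBelow i with offeredShape (suc m) S i
  ... | increasing , positive , allowed with optionValue isMax v increasing positive allowed
  ...   | b , b<a , _ , isMax′ , v′ = b , b<a , quantumValue m isMax′ v′
  reachesBelow : ∀ t → t < a → Σ (Fin (length (allowedQMoves (suc m) S))) λ i → qOption (suc m) S i ≈G nim t
  reachesBelow t t<a with reachable isMax v t<a
  ... | js , (i , eq) , _ , isMax′ , v′ =
    i , subst (λ js → qgame (suc m) (result (suc m) S js) ≈G nim t) (sym eq) (quantumValue m isMax′ v′)

positionOf : List ℕ → ℕ → Bool
positionOf is y = any (y ≡ᵇ_) is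

positionOf⇒ : ∀ is {y} → T (positionOf is y) → y ∈ is
positionOf⇒ is {y} t = Any.map (≡ᵇ⇒≡ y _) (any⁻ _ is t)

positionOf⇐ : ∀ is {y} → y ∈ is → T (positionOf is y)
positionOf⇐ is {y} y∈is = any⁺ _ (Any.map (≡⇒≡ᵇ y _) y∈is)

maxList-upper : ∀ {x} is → x ∈ is → x ≤ maxList is
maxList-upper (a ∷ is) (here refl) = m≤m⊔n a (maxList is)
maxList-upper (a ∷ is) (there x∈is) = ≤-trans (maxList-upper is x∈is) (m≤n⊔m a (maxList is))

maxList-∈ : ∀ a is → maxList (a ∷ is) ∈ a ∷ is
maxList-∈ a [] = here (⊔-identityʳ a)
maxList-∈ a (b ∷ is) with ⊔-sel a (maxList (b ∷ is))
... | inj₁ max≡a = here max≡a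
... | inj₂ max≡rest = there (subst (_∈ b ∷ is) (sym max≡rest) (maxList-∈ b is))

positionMax : ∀ a is → IsMax (maxList (a ∷ is)) (positionOf (a ∷ is)) (maxList (a ∷ is))
positionMax a is = positionOf⇐ (a ∷ is) (maxList-∈ a is) , ≤-refl ,
                   λ _ sx → maxList-upper (a ∷ is) (positionOf⇒ (a ∷ is) sx)

belowMax : ∀ {x y} is → x ∈ is → y ∈ is → x ≢ y → Σ ℕ λ z → z ∈ is × z < maxList is
belowMax {x} {y} is x∈is y∈is x≢y with x ≟ maxList is
... | no x≢max = x , x∈is , ≤∧≢⇒< (maxList-upper is x∈is) x≢max
... | yes x≡max = y , y∈is , ≤∧≢⇒< (maxList-upper is y∈is) (λ y≡max → x≢y (trans x≡max (sym y≡max)))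

mainTheorem7 : (is : List ℕ) → is ≢ [] → Unique is →
    (length is ≡ 1 → quantumNim is ≈G nim (maxList is))
    × (length is ≢ 1 → quantumNim is ≈G nim (maxList is ∸ 1))
mainTheorem7 [] nonempty _ = ⊥-elim (nonempty refl)
mainTheorem7 (a ∷ []) _ _ =
  (λ _ → quantumValue _ (positionMax a []) (single onlyElement)) , (λ length≢1 → ⊥-elim (length≢1 refl))
  where
  onlyElement : IsOnly (maxList (a ∷ [])) (positionOf (a ∷ [])) (maxList (a ∷ []))
  onlyElement {x} _ sx with positionOf⇒ (a ∷ []) {x} sx
  ... | here refl = sym (⊔-identityʳ a)
mainTheorem7 is@(a ∷ b ∷ r) _ ((a≢b ∷ _) ∷ _) =
  (λ ()) , (λ _ → quantumValue _ (positionMax a (b ∷ r)) (multi below))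
  where
  below : HasBelow (positionOf is) (maxList is)
  below with belowMax is (here refl) (there (here refl)) a≢b
  ... | z , z∈is , z<max = z , z<max , positionOf⇐ is z∈is
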